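{- The ideal $I$ of all elements of $\mathcal U$ that act as zero on $\mathbf C[\mathbf Y]$ is a binomial ideal: it is generated (as a two-sided ideal) by the elements $u_x-u_y$, where $x,y$ are words over $\Gamma$ with $u_x-u_y\in I$.
   Context: A partition is a nonincreasing sequence of nonnegative integers with finite sum; $\lambda'$ is the conjugate ($\lambda'_i$ = number of boxes in column $i$). $\mathbf Y$ is the set of partitions and $\mathbf C[\mathbf Y]$ the complex vector space with basis $\mathbf Y$. $\Gamma=\{1,2,\dots\}\cup\{\bar1,\bar2,\dots\}$; $\mathcal U$ is the free associative $\mathbf C$-algebra on generators $u_a$, $a\in\Gamma$, with $d_i=u_{\bar i}$; for a word $x=x_1\cdots x_\ell$, $u_x=u_{x_1}\cdots u_{x_\ell}$. $\mathcal U$ acts on $\mathbf C[\mathbf Y]$ with products acting as compositions, where $u_i(\lambda)$ is the partition obtained from $\lambda$ by adding a box to column $i$ if that is a partition and $0$ otherwise, and $d_i(\lambda)$ is obtained by removing a box from column $i$ if that is a partition and $0$ otherwise. -}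

module Defs where

open import Level using (Level; _⊔_) renaming (suc to lsuc)
open import Algebra.Bundles using (CommutativeRing)
open import Data.Nat using (ℕ; zero; suc; _≥_; _≤?_) renaming (_≟_ to _≟ℕ_; _⊔_ to _⊔ℕ_)

open import Data.List using (List; []; _∷_; _++_; map; concat; concatMap; filter; length; foldr; applyUpTo)
open import Data.List.Properties using (≡-dec)
open import Data.List.Relation.Unary.All using (All)
open import Data.List.Relation.Unary.Linked using (Linked; linked?)
open import Data.Maybe using (Maybe; just; nothing)
import Data.Maybe as Maybe
open import Data.Product using (_×_; _,_; Σ; ∃; ∃₂)
open import Data.Bool using (if_then_else_)
open import Relation.Nullary using (¬_; Dec; yes; no; does)
open import Relation.Binary.PropositionalEquality using (_≡_; refl; cong)
import Data.Nat.Properties as ℕP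

record Field (c ℓ : Level) : Set (lsuc (c ⊔ ℓ)) where
  field
    commutativeRing : CommutativeRing c ℓ
  open CommutativeRing commutativeRing public
  field
    1≉0     : ¬ (1# ≈ 0#)
    inverse : ∀ x → ¬ (x ≈ 0#) → Σ Carrier (λ y → x * y ≈ 1#)

-- Partitions: finite lists of positive parts, nonincreasing
-- (i.e. a partition with its trailing zeros dropped).

IsPartition : List ℕ → Set
IsPartition l = Linked _≥_ l × All (λ n → n ≥ 1) l

record Partition : Set where
  constructor mkPartition
  field
    parts      : List ℕ
    isPartition : IsPartition parts
open Partition public

-- length of column c (c ≥ 1): number of parts ≥ c
colLen : ℕ → List ℕ → ℕ
colLen c l = length (filter (λ r → c ≤? r) l)

maxPart : List ℕ → ℕ
maxPart = foldr _⊔ℕ_ 0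

-- list of column lengths of the diagram with row lengths l
-- (for any list l of naturals the resulting diagram is
--  { (r , c) | c ≤ l_r }, whose columns are colLen 1 l , … , colLen (max l) l)
conj : List ℕ → List ℕ
conj l = applyUpTo (λ k → colLen (suc k) l) (maxPart l)

incrAt : ℕ → List ℕ → List ℕ
incrAt zero    []      = 1 ∷ []
incrAt zero    (x ∷ l) = suc x ∷ l
incrAt (suc k) []      = 0 ∷ incrAt k []
incrAt (suc k) (x ∷ l) = x ∷ incrAt k l

decrAt : ℕ → List ℕ → Maybe (List ℕ)
decrAt zero    []          = nothing
decrAt zero    (zero ∷ l)  = nothing
decrAt zero    (suc x ∷ l) = just (x ∷ l)
decrAt (suc k) []          = nothing
decrAt (suc k) (x ∷ l)     = Maybe.map (x ∷_) (decrAt k l)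

-- a column-length sequence describes a partition iff it is nonincreasing
-- (trailing zeros allowed, as in the paper's definition of partition)
toPartition : List ℕ → Maybe (List ℕ)
toPartition cols =
  if does (linked? (λ m n → m ℕP.≥? n) cols) then just (conj cols) else nothing

-- Alphabet Γ = {1,2,…} ∪ {1̄,2̄,…}.
-- up i  stands for the letter  i+1   (generator u_{i+1})
-- dn i  stands for the letter  \bar{i+1} (generator d_{i+1} = u_{\bar{i+1}})

data Γ : Set where
  up : ℕ → Γ
  dn : ℕ → Γ

_≟Γ_ : (a b : Γ) → Dec (a ≡ b)
up i ≟Γ up j with i ≟ℕ j
... | yes refl = yes refl
... | no ne    = no (λ { refl → ne refl })
up i ≟Γ dn j = no (λ ())
dn i ≟Γ up j = no (λ ())
dn i ≟Γ dn j with i ≟ℕ j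
... | yes refl = yes refl
... | no ne    = no (λ { refl → ne refl })

Word : Set
Word = List Γ

_≟W_ : (x y : Word) → Dec (x ≡ y)
_≟W_ = ≡-dec _≟Γ_

-- action of a generator on a partition (row-length list); nothing = 0
actGen : Γ → List ℕ → Maybe (List ℕ)
actGen (up i) λ′ = toPartition (incrAt i (conj λ′))
actGen (dn i) λ′ with decrAt i (conj λ′)
... | nothing   = nothing
... | just cols = toPartition cols

-- u_x = u_{x₁} ⋯ u_{x_ℓ} acts as a composition (x_ℓ applied first)
actWord : Word → List ℕ → Maybe (List ℕ)
actWord []      λ′ = just λ′
actWord (a ∷ x) λ′ = Maybe._>>=_ (actWord x λ′) (actGen a)

module FreeAlgebra {c ℓ : Level} (K : Field c ℓ) where
  open Field K

  𝒰 : Set c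
  𝒰 = List (Carrier × Word)

  coeffU : Word → 𝒰 → Carrier
  coeffU w []            = 0#
  coeffU w ((a , v) ∷ f) = if does (v ≟W w) then a + coeffU w f else coeffU w f

  _≃_ : 𝒰 → 𝒰 → Set ℓ
  f ≃ g = ∀ w → coeffU w f ≈ coeffU w g

  mon : Word → 𝒰
  mon x = (1# , x) ∷ []

  binom : Word → Word → 𝒰
  binom x y = (1# , x) ∷ (- 1# , y) ∷ []

  _⊕_ : 𝒰 → 𝒰 → 𝒰
  _⊕_ = _++_

  _⊗_ : 𝒰 → 𝒰 → 𝒰
  f ⊗ g = concatMap (λ { (a , v) → map (λ { (b , w) → (a * b , v ++ w) }) g }) f

  KY : Set c
  KY = List (Carrier × List ℕ)

  coeffY : List ℕ → KY → Carrier
  coeffY μ []            = 0#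
  coeffY μ ((a , ν) ∷ v) = if does (≡-dec _≟ℕ_ ν μ) then a + coeffY μ v else coeffY μ v

  act : 𝒰 → List ℕ → KY
  act []            λ′ = []
  act ((a , w) ∷ f) λ′ with actWord w λ′
  ... | nothing = act f λ′
  ... | just μ  = (a , μ) ∷ act f λ′

  InI : 𝒰 → Set ℓ
  InI f = ∀ (λ′ μ : Partition) → coeffY (parts μ) (act f (parts λ′)) ≈ 0#

  BinomialInI : 𝒰 → Set (c ⊔ ℓ)
  BinomialInI g = ∃₂ λ x y → g ≡ binom x y × InI (binom x y)

  sumTerms : List (𝒰 × 𝒰 × 𝒰) → 𝒰
  sumTerms []                  = []
  sumTerms ((a , s , b) ∷ ts)  = ((a ⊗ s) ⊗ b) ⊕ sumTerms ts

  InIdeal : ∀ {p} → (𝒰 → Set p) → 𝒰 → Set (c ⊔ ℓ ⊔ p)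
  InIdeal S f = ∃ λ (ts : List (𝒰 × 𝒰 × 𝒰)) →
                  All (λ { (a , s , b) → S s }) ts × f ≃ sumTerms ts

{-# OPTIONS --safe #-}
-- If u_x − u_y ∈ I then x and y act identically on partitions, hence so do p x w and p y w; so the
-- ideal generated by these binomials lies in I.
-- Conversely, record a partition by its multiplicities m₁, m₂, …. A generator u_{i+1} or d_{i+1}
-- moves one unit between two neighbouring multiplicities, so in each slot a word acts through the
-- bicyclic monoid of partial maps n ↦ n ∸ k + k′ (defined for k ≤ n), and words with equal images in
-- every slot act identically. For f ∈ I let A be a word of f of least total demand Σ k, and ρ the
-- partition whose multiplicities are A's demands. The words of f sending ρ where A sends it have the
-- same bicyclic images as A, and their coefficients sum to the coefficient of u_A(ρ) in f(ρ), which is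
-- zero. Subtracting Σ c_v (u_v − u_A) over these words leaves a shorter element of I.

module Submission where

open import Defs
open import Level using (Level)
open import Function.Bundles using (_⇔_; mk⇔; Equivalence)

module Partitions where

  open import Function.Base using (_∘_)
  open import Data.Nat
  open import Data.Nat.Properties
  open import Data.Nat.ListAction using (sum)
  open import Data.List using (List; []; _∷_; _++_; length; filter; applyUpTo; map)
  open import Data.List.Properties using (filter-accept; filter-reject; filter-none; filter-some)
  open import Data.List.Relation.Unary.All as All using (All; []; _∷_)
  open import Data.List.Relation.Unary.Any using (Any; here; there)
  open import Data.List.Relation.Unary.Linked as Linked using (Linked; []; [-]; _∷_)
  import Data.List.Relation.Unary.Linked.Properties as Linkedₚ
  import Data.List.Relation.Unary.All.Properties as Allₚ
  open import Data.List.Relation.Binary.Sublist.Propositional using (_⊆_; ⊆-refl)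
  open import Data.List.Relation.Binary.Sublist.Propositional.Properties using (filter⁺; length-mono-≤)
  open import Data.Product using (_×_; _,_; proj₁; proj₂; ∃)
  open import Data.Sum using (_⊎_; inj₁; inj₂)
  open import Data.Maybe using (Maybe; just; nothing; _>>=_)
  open import Data.Maybe.Properties using (just-injective)
  open import Data.List.Extrema.Nat using (max; xs≤max)
  open import Data.List.Relation.Unary.Linked using (linked?)
  open import Relation.Nullary using (¬_; yes; no; contradiction)
  open import Relation.Binary.PropositionalEquality

  open Equivalence using (to; from)

  Antitone : (ℕ → ℕ) → Set
  Antitone f = ∀ k → f (suc k) ≤ f k

  antitone-≤-head : ∀ {f} → Antitone f → ∀ k → f k ≤ f 0
  antitone-≤-head anti zero    = ≤-refl
  antitone-≤-head anti (suc k) = ≤-trans (anti k) (antitone-≤-head anti k)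

  <-ext : ∀ {a b} → (∀ k → k < a ⇔ k < b) → a ≡ b
  <-ext {a} {b} h = ≤-antisym (≮⇒≥ (λ b<a → n≮n b (to (h b) b<a)))
                              (≮⇒≥ (λ a<b → n≮n a (from (h a) a<b)))

  -- An antitone sequence that vanishes eventually is the sum of its later differences.
  differences-injective : ∀ B {f g} → Antitone f → Antitone g →
    (∀ k → B ≤ k → f k ≡ 0) → (∀ k → B ≤ k → g k ≡ 0) →
    (∀ j → f j ∸ f (suc j) ≡ g j ∸ g (suc j)) → ∀ k → f k ≡ g k
  differences-injective B {f} {g} anti-f anti-g f0 g0 diff k = go B k (m≤n+m B k)
    where
    go : ∀ d k → B ≤ k + d → f k ≡ g k
    go zero    k B≤k = trans (f0 k B≤k′) (sym (g0 k B≤k′))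
      where B≤k′ = subst (B ≤_) (+-identityʳ k) B≤k
    go (suc d) k B≤k = begin
      f k                         ≡⟨ sym (m∸n+n≡m (anti-f k)) ⟩
      f k ∸ f (suc k) + f (suc k) ≡⟨ cong₂ _+_ (diff k) (go d (suc k) (subst (B ≤_) (+-suc k d) B≤k)) ⟩
      g k ∸ g (suc k) + g (suc k) ≡⟨ m∸n+n≡m (anti-g k) ⟩
      g k                         ∎
      where open ≡-Reasoning

  entry : List ℕ → ℕ → ℕ
  entry []      k       = 0
  entry (x ∷ l) zero    = x
  entry (x ∷ l) (suc k) = entry l k

  entry-applyUpTo : ∀ f n k → k < n → entry (applyUpTo f n) k ≡ f k
  entry-applyUpTo f (suc n) zero    _         = refl
  entry-applyUpTo f (suc n) (suc k) (s≤s k<n) = entry-applyUpTo (f ∘ suc) n k k<n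

  entry-applyUpTo-≥ : ∀ f n k → n ≤ k → entry (applyUpTo f n) k ≡ 0
  entry-applyUpTo-≥ f zero    k       _         = refl
  entry-applyUpTo-≥ f (suc n) (suc k) (s≤s n≤k) = entry-applyUpTo-≥ (f ∘ suc) n k n≤k

  entry≤maxPart : ∀ l k → entry l k ≤ maxPart l
  entry≤maxPart []      k       = z≤n
  entry≤maxPart (x ∷ l) zero    = m≤m⊔n x (maxPart l)
  entry≤maxPart (x ∷ l) (suc k) = ≤-trans (entry≤maxPart l k) (m≤n⊔m x (maxPart l))

  linked⇒entry-antitone : ∀ {l} → Linked _≥_ l → Antitone (entry l)
  linked⇒entry-antitone []           k       = z≤n
  linked⇒entry-antitone [-]          k       = z≤n
  linked⇒entry-antitone (x≥y ∷ _)    zero    = x≥y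
  linked⇒entry-antitone (_ ∷ linked) (suc k) = linked⇒entry-antitone linked k

  entry-antitone⇒linked : ∀ l → Antitone (entry l) → Linked _≥_ l
  entry-antitone⇒linked []          _    = []
  entry-antitone⇒linked (x ∷ [])    _    = [-]
  entry-antitone⇒linked (x ∷ y ∷ l) anti = anti 0 ∷ entry-antitone⇒linked (y ∷ l) (anti ∘ suc)

  entry-injective : ∀ {l m} → All (_≥ 1) l → All (_≥ 1) m → (∀ k → entry l k ≡ entry m k) → l ≡ m
  entry-injective []          []          _  = refl
  entry-injective []          (b≥1 ∷ _)   eq = contradiction (eq 0) (<⇒≢ b≥1)
  entry-injective (a≥1 ∷ _)   []          eq = contradiction (sym (eq 0)) (<⇒≢ a≥1)
  entry-injective (_ ∷ pos-l) (_ ∷ pos-m) eq = cong₂ _∷_ (eq 0) (entry-injective pos-l pos-m (eq ∘ suc))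

  colLen-accept : ∀ {c x} l → c ≤ x → colLen c (x ∷ l) ≡ suc (colLen c l)
  colLen-accept {c} l c≤x = cong length (filter-accept (c ≤?_) c≤x)

  colLen-reject : ∀ {c x} l → ¬ c ≤ x → colLen c (x ∷ l) ≡ colLen c l
  colLen-reject {c} l c≰x = cong length (filter-reject (c ≤?_) c≰x)

  colLen-antitone : ∀ {c c′} l → c ≤ c′ → colLen c′ l ≤ colLen c l
  colLen-antitone {c} {c′} l c≤c′ = length-mono-≤ sublist
    where
    sublist : filter (c′ ≤?_) l ⊆ filter (c ≤?_) l
    sublist = filter⁺ (c′ ≤?_) (c ≤?_) {as = l} {bs = l} (λ { refl c′≤x → ≤-trans c≤c′ c′≤x }) ⊆-refl

  colLen-above : ∀ {c} l → All (_< c) l → colLen c l ≡ 0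
  colLen-above {c} l l<c = cong length (filter-none (c ≤?_) (All.map <⇒≱ l<c))

  maxPart-upper : ∀ l → All (_≤ maxPart l) l
  maxPart-upper []      = []
  maxPart-upper (x ∷ l) = m≤m⊔n x (maxPart l) ∷ All.map (λ y≤m → ≤-trans y≤m (m≤n⊔m x (maxPart l))) (maxPart-upper l)

  <maxPart⇒any : ∀ {k} l → k < maxPart l → Any (k <_) l
  <maxPart⇒any {k} (x ∷ l) k<max with ⊔-sel x (maxPart l)
  ... | inj₁ x⊔m≡x = here (subst (k <_) x⊔m≡x k<max)
  ... | inj₂ x⊔m≡m = there (<maxPart⇒any l (subst (k <_) x⊔m≡m k<max))

  col : List ℕ → ℕ → ℕ
  col l k = colLen (suc k) l

  -- mult l j is the multiplicity of the part j + 1 in l (columns and multiplicities are indexed from 0).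
  mult : List ℕ → ℕ → ℕ
  mult l j = col l j ∸ col l (suc j)

  col-antitone : ∀ l → Antitone (col l)
  col-antitone l k = colLen-antitone l (n≤1+n (suc k))

  col-beyond : ∀ l k → maxPart l ≤ k → col l k ≡ 0
  col-beyond l k max≤k = colLen-above l (All.map (λ x≤max → s≤s (≤-trans x≤max max≤k)) (maxPart-upper l))

  col-positive : ∀ l k → k < maxPart l → 0 < col l k
  col-positive l k k<max = filter-some (suc k ≤?_) (<maxPart⇒any l k<max)

  entry-conj : ∀ l k → entry (conj l) k ≡ col l k
  entry-conj l k with k <? maxPart l
  ... | yes k<max = entry-applyUpTo (col l) (maxPart l) k k<max
  ... | no  k≮max = trans (entry-applyUpTo-≥ (col l) (maxPart l) k (≮⇒≥ k≮max))
                          (sym (col-beyond l k (≮⇒≥ k≮max)))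

  conj-isPartition : ∀ l → IsPartition (conj l)
  conj-isPartition l = Linkedₚ.applyUpTo⁺₂ (col l) (maxPart l) (col-antitone l)
                     , Allₚ.applyUpTo⁺₁ (col l) (maxPart l) (col-positive l _)

  -- Both sides say that the box in row j, column k (counted from 0) lies in the diagram of L.
  j<col⇔k<entry : ∀ {L} → Linked _≥_ L → ∀ j k → (j < col L k ⇔ k < entry L j)
  j<col⇔k<entry [] j k = mk⇔ (λ ()) (λ ())
  j<col⇔k<entry {x ∷ L} linked j k with k <? x
  ... | yes k<x rewrite colLen-accept L k<x = shape j
    where
    shape : ∀ j → (j < suc (col L k) ⇔ k < entry (x ∷ L) j)
    shape zero    = mk⇔ (λ _ → k<x) (λ _ → s≤s z≤n)
    shape (suc j) = mk⇔ (to (j<col⇔k<entry tail j k) ∘ ≤-pred) (s≤s ∘ from (j<col⇔k<entry tail j k))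
      where tail = Linked.tail linked
  ... | no k≮x rewrite colLen-reject L k≮x =
    mk⇔ (λ j<col → contradiction (≤-trans (to (j<col⇔k<entry (Linked.tail linked) 0 k) (≤-trans (s≤s z≤n) j<col))
                                           (linked⇒entry-antitone linked 0)) k≮x)
        (λ k<entry → contradiction (≤-trans k<entry (antitone-≤-head (linked⇒entry-antitone linked) j)) k≮x)

  colLen-applyUpTo : ∀ c h n m → m ≤ n → (∀ k → k < n → (c ≤ h k ⇔ k < m)) →
                     colLen c (applyUpTo h n) ≡ m
  colLen-applyUpTo c h zero    zero    _         _   = refl
  colLen-applyUpTo c h (suc n) zero    _         thr =
    trans (colLen-reject (applyUpTo (h ∘ suc) n) (λ c≤h0 → contradiction (to (thr 0 (s≤s z≤n)) c≤h0) (λ ())))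
          (colLen-applyUpTo c (h ∘ suc) n zero z≤n
            (λ k k<n → mk⇔ (λ c≤h → contradiction (to (thr (suc k) (s≤s k<n)) c≤h) (λ ())) (λ ())))
  colLen-applyUpTo c h (suc n) (suc m) (s≤s m≤n) thr =
    trans (colLen-accept (applyUpTo (h ∘ suc) n) (from (thr 0 (s≤s z≤n)) (s≤s z≤n)))
          (cong suc (colLen-applyUpTo c (h ∘ suc) n m m≤n
            (λ k k<n → mk⇔ (≤-pred ∘ to (thr (suc k) (s≤s k<n))) (from (thr (suc k) (s≤s k<n)) ∘ s≤s))))

  col-conj : ∀ {L} → Linked _≥_ L → ∀ j → col (conj L) j ≡ entry L j
  col-conj {L} linked j = colLen-applyUpTo (suc j) (col L) (maxPart L) (entry L j) (entry≤maxPart L j)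
                            (λ k _ → j<col⇔k<entry linked j k)

  mult-conj : ∀ {L} → Linked _≥_ L → ∀ j → mult (conj L) j ≡ entry L j ∸ entry L (suc j)
  mult-conj linked j = cong₂ _∸_ (col-conj linked j) (col-conj linked (suc j))

  col-injective : ∀ {l m} → IsPartition l → IsPartition m → (∀ k → col l k ≡ col m k) → l ≡ m
  col-injective (linked-l , pos-l) (linked-m , pos-m) eq = entry-injective pos-l pos-m λ j → <-ext λ k →
    mk⇔ (to (j<col⇔k<entry linked-m j k) ∘ subst (j <_) (eq k) ∘ from (j<col⇔k<entry linked-l j k))
        (to (j<col⇔k<entry linked-l j k) ∘ subst (j <_) (sym (eq k)) ∘ from (j<col⇔k<entry linked-m j k))

  mult-injective : ∀ {l m} → IsPartition l → IsPartition m → (∀ j → mult l j ≡ mult m j) → l ≡ m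
  mult-injective {l} {m} part-l part-m eq = col-injective part-l part-m
    (differences-injective (maxPart l ⊔ maxPart m) (col-antitone l) (col-antitone m)
      (λ k le → col-beyond l k (≤-trans (m≤m⊔n _ _) le)) (λ k le → col-beyond m k (≤-trans (m≤n⊔m _ _) le)) eq)

  -- The column lengths K k + K (k + 1) + ⋯ of the partition with multiplicities K, when K vanishes from n on.
  colsOf : ℕ → (ℕ → ℕ) → List ℕ
  colsOf zero    K = []
  colsOf (suc n) K = sum (applyUpTo K (suc n)) ∷ colsOf n (K ∘ suc)

  entry-colsOf-head : ∀ n K → entry (colsOf n K) 0 ≡ sum (applyUpTo K n)
  entry-colsOf-head zero    K = refl
  entry-colsOf-head (suc n) K = refl

  entry-colsOf : ∀ n K → (∀ j → n ≤ j → K j ≡ 0) → ∀ k → entry (colsOf n K) k ≡ K k + entry (colsOf n K) (suc k)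
  entry-colsOf zero    K K≥0 k       = sym (trans (+-identityʳ (K k)) (K≥0 k z≤n))
  entry-colsOf (suc n) K K≥0 zero    = cong (K 0 +_) (sym (entry-colsOf-head n (K ∘ suc)))
  entry-colsOf (suc n) K K≥0 (suc k) = entry-colsOf n (K ∘ suc) (λ j n≤j → K≥0 (suc j) (s≤s n≤j)) k

  withMult : ℕ → (ℕ → ℕ) → List ℕ
  withMult n K = conj (colsOf n K)

  mult-withMult : ∀ n K → (∀ j → n ≤ j → K j ≡ 0) → ∀ j → mult (withMult n K) j ≡ K j
  mult-withMult n K K≥0 j = begin
    mult (conj (colsOf n K)) j                   ≡⟨ mult-conj linked j ⟩
    entry L j ∸ entry L (suc j)                  ≡⟨ cong (_∸ entry L (suc j)) (entry-colsOf n K K≥0 j) ⟩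
    K j + entry L (suc j) ∸ entry L (suc j)      ≡⟨ m+n∸n≡m (K j) (entry L (suc j)) ⟩
    K j                                          ∎
    where
    open ≡-Reasoning
    L = colsOf n K
    linked : Linked _≥_ L
    linked = entry-antitone⇒linked L λ k →
      subst (entry L (suc k) ≤_) (sym (entry-colsOf n K K≥0 k)) (m≤n+m (entry L (suc k)) (K k))

  δ : ℕ → ℕ → ℕ
  δ zero    zero    = 1
  δ zero    (suc k) = 0
  δ (suc i) zero    = 0
  δ (suc i) (suc k) = δ i k

  δ-diagonal : ∀ i → δ i i ≡ 1
  δ-diagonal zero    = refl
  δ-diagonal (suc i) = δ-diagonal i

  δ-< : ∀ {i j} → i < j → δ i j ≡ 0
  δ-< {zero}  {suc j} _         = refl
  δ-< {suc i} {suc j} (s≤s i<j) = δ-< i<j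

  δ-adjacent : ∀ i j → δ i j ≡ 0 ⊎ δ i (suc j) ≡ 0
  δ-adjacent zero    j       = inj₂ refl
  δ-adjacent (suc i) zero    = inj₁ refl
  δ-adjacent (suc i) (suc j) = δ-adjacent i j

  entry-incrAt : ∀ i M k → entry (incrAt i M) k ≡ entry M k + δ i k
  entry-incrAt zero    []      zero    = refl
  entry-incrAt zero    []      (suc k) = refl
  entry-incrAt zero    (x ∷ M) zero    = +-comm 1 x
  entry-incrAt zero    (x ∷ M) (suc k) = sym (+-identityʳ (entry M k))
  entry-incrAt (suc i) []      zero    = refl
  entry-incrAt (suc i) []      (suc k) = entry-incrAt i [] k
  entry-incrAt (suc i) (x ∷ M) zero    = sym (+-identityʳ x)
  entry-incrAt (suc i) (x ∷ M) (suc k) = entry-incrAt i M k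

  entry-decrAt : ∀ i M {M′} → decrAt i M ≡ just M′ → ∀ k → entry M k ≡ entry M′ k + δ i k
  entry-decrAt zero    (suc x ∷ M) refl zero    = +-comm 1 x
  entry-decrAt zero    (suc x ∷ M) refl (suc k) = sym (+-identityʳ (entry M k))
  entry-decrAt (suc i) (x ∷ M)     eq   k with decrAt i M in eq′
  entry-decrAt (suc i) (x ∷ M) refl zero    | just N = sym (+-identityʳ x)
  entry-decrAt (suc i) (x ∷ M) refl (suc k) | just N = entry-decrAt i M eq′ k

  decrAt-nothing : ∀ i M → decrAt i M ≡ nothing → entry M i ≡ 0
  decrAt-nothing zero    []         _  = refl
  decrAt-nothing zero    (zero ∷ M) _  = refl
  decrAt-nothing (suc i) []         _  = refl
  decrAt-nothing (suc i) (x ∷ M)    eq with decrAt i M in eq′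
  ... | nothing = decrAt-nothing i M eq′

  toPartition-linked : ∀ {L} → Linked _≥_ L → toPartition L ≡ just (conj L)
  toPartition-linked {L} linked with linked? (λ m n → m ≥? n) L
  ... | yes _        = refl
  ... | no  unlinked = contradiction linked unlinked

  toPartition-just : ∀ L {ν} → toPartition L ≡ just ν → Linked _≥_ L × conj L ≡ ν
  toPartition-just L eq with linked? (λ m n → m ≥? n) L
  toPartition-just L refl | yes linked = linked , refl

  -- (k , k′) acts on ℕ as the partial map n ↦ n ∸ k + k′, defined when k ≤ n. These maps form the
  -- bicyclic monoid; p ∙ q is "first p, then q".
  step : ℕ × ℕ → ℕ → Maybe ℕ
  step (k , k′) n with k ≤? n
  ... | yes _ = just (n ∸ k + k′)
  ... | no  _ = nothing

  _∙_ : ℕ × ℕ → ℕ × ℕ → ℕ × ℕ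
  (k₁ , k₁′) ∙ (k₂ , k₂′) = (k₁ + (k₂ ∸ k₁′) , (k₁′ ∸ k₂) + k₂′)

  step-enabled : ∀ {k k′ n} → k ≤ n → step (k , k′) n ≡ just (n ∸ k + k′)
  step-enabled {k} {k′} {n} k≤n with k ≤? n
  ... | yes _   = refl
  ... | no  k≰n = contradiction k≤n k≰n

  step-disabled : ∀ {k k′ n} → ¬ k ≤ n → step (k , k′) n ≡ nothing
  step-disabled {k} {k′} {n} k≰n with k ≤? n
  ... | yes k≤n = contradiction k≤n k≰n
  ... | no  _   = refl

  step-just : ∀ {k k′ n m} → step (k , k′) n ≡ just m → k ≤ n × n ∸ k + k′ ≡ m
  step-just {k} {k′} {n} eq with k ≤? n
  step-just refl | yes k≤n = k≤n , refl

  step-identity : ∀ n → step (0 , 0) n ≡ just n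
  step-identity n = trans (step-enabled {0} {0} {n} z≤n) (cong just (+-identityʳ n))

  step-inverse : ∀ {k k′ n m} → step (k , k′) n ≡ just m → step (k′ , k) m ≡ just n
  step-inverse {k} {k′} {n} eq with step-just eq
  ... | k≤n , refl = trans (step-enabled (m≤n+m k′ (n ∸ k)))
                           (cong just (trans (cong (_+ k) (m+n∸n≡m (n ∸ k) k′)) (m∸n+n≡m k≤n)))

  +∸-split : ∀ r k k′ → k ≤ r + k′ → r + k′ ∸ k ≡ r ∸ (k ∸ k′) + (k′ ∸ k)
  +∸-split r zero    k′       _  = cong (_+ k′) (sym (cong (r ∸_) (0∸n≡0 k′)))
  +∸-split r (suc k) zero     _  = trans (cong (_∸ suc k) (+-identityʳ r)) (sym (+-identityʳ (r ∸ suc k)))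
  +∸-split r (suc k) (suc k′) le = trans (cong (_∸ suc k) (+-suc r k′))
                                         (+∸-split r k k′ (≤-pred (subst (suc k ≤_) (+-suc r k′) le)))

  +≤⇔≤∸ : ∀ {k n} d → k ≤ n → (k + d ≤ n ⇔ d ≤ n ∸ k)
  +≤⇔≤∸ {k} {n} d k≤n = mk⇔ (λ le → m+n≤o⇒m≤o∸n d (subst (_≤ n) (+-comm k d) le))
                            (λ le → subst (_≤ n) (+-comm d k) (m≤o∸n⇒m+n≤o d k≤n le))

  ∸≤⇔≤+ : ∀ k k′ r → (k ∸ k′ ≤ r ⇔ k ≤ r + k′)
  ∸≤⇔≤+ k k′ r = mk⇔ (λ le → ≤-trans (m≤n+m∸n k k′) (subst (k′ + (k ∸ k′) ≤_) (+-comm k′ r) (+-monoʳ-≤ k′ le)))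
                     (λ le → m≤n+o⇒m∸n≤o k k′ (subst (k ≤_) (+-comm r k′) le))

  step-∙ : ∀ p q n → step (p ∙ q) n ≡ (step p n >>= step q)
  step-∙ (k₁ , k₁′) (k₂ , k₂′) n with k₁ ≤? n
  ... | no k₁≰n = step-disabled (λ le → k₁≰n (≤-trans (m≤m+n k₁ (k₂ ∸ k₁′)) le))
  ... | yes k₁≤n with k₂ ≤? n ∸ k₁ + k₁′
  ...   | no k₂≰s  = step-disabled (k₂≰s ∘ to (∸≤⇔≤+ k₂ k₁′ (n ∸ k₁)) ∘ to (+≤⇔≤∸ (k₂ ∸ k₁′) k₁≤n))
  ...   | yes k₂≤s = trans (step-enabled (from (+≤⇔≤∸ (k₂ ∸ k₁′) k₁≤n) (from (∸≤⇔≤+ k₂ k₁′ r) k₂≤s)))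
                           (cong just value)
    where
    open ≡-Reasoning
    r = n ∸ k₁
    value : n ∸ (k₁ + (k₂ ∸ k₁′)) + ((k₁′ ∸ k₂) + k₂′) ≡ r + k₁′ ∸ k₂ + k₂′
    value = begin
      n ∸ (k₁ + (k₂ ∸ k₁′)) + ((k₁′ ∸ k₂) + k₂′) ≡⟨ cong (_+ (k₁′ ∸ k₂ + k₂′)) (sym (∸-+-assoc n k₁ (k₂ ∸ k₁′))) ⟩
      r ∸ (k₂ ∸ k₁′) + ((k₁′ ∸ k₂) + k₂′)         ≡⟨ sym (+-assoc (r ∸ (k₂ ∸ k₁′)) (k₁′ ∸ k₂) k₂′) ⟩
      r ∸ (k₂ ∸ k₁′) + (k₁′ ∸ k₂) + k₂′           ≡⟨ cong (_+ k₂′) (sym (+∸-split r k₂ k₁′ k₂≤s)) ⟩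
      r + k₁′ ∸ k₂ + k₂′                          ∎

  -- a and b are the lengths of two adjacent columns without the box that u_{i+1} adds (or d_{i+1}
  -- removes), and x, y are that box's contributions to them.
  up-step : ∀ {a b x y} → x ≡ 0 ⊎ y ≡ 0 → b ≤ a → b + y ≤ a + x → step (y , x) (a ∸ b) ≡ just (a + x ∸ (b + y))
  up-step {a} {b} {x} {y} (inj₁ refl) b≤a le =
    trans (step-enabled (to (+≤⇔≤∸ y b≤a) (subst (b + y ≤_) (+-identityʳ a) le)))
          (cong just (trans (+-identityʳ (a ∸ b ∸ y)) (trans (∸-+-assoc a b y) (cong (_∸ (b + y)) (sym (+-identityʳ a))))))
  up-step {a} {b} {x} {y} (inj₂ refl) b≤a le =
    trans (step-enabled {0} {x} {a ∸ b} z≤n) (cong just (sym (trans (cong (a + x ∸_) (+-identityʳ b)) (+-∸-comm x b≤a))))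

  up-enabled : ∀ {a b x y} → x ≡ 0 ⊎ y ≡ 0 → b ≤ a → y ≤ a ∸ b → b + y ≤ a + x
  up-enabled {a} {b} {x} {y} (inj₁ refl) b≤a le = subst (b + y ≤_) (sym (+-identityʳ a)) (from (+≤⇔≤∸ y b≤a) le)
  up-enabled {a} {b} {x} {y} (inj₂ refl) b≤a _  = subst (_≤ a + x) (sym (+-identityʳ b)) (≤-trans b≤a (m≤m+n a x))

  dn-step : ∀ {a b x y} → x ≡ 0 ⊎ y ≡ 0 → b + y ≤ a + x → b ≤ a → step (x , y) (a + x ∸ (b + y)) ≡ just (a ∸ b)
  dn-step excl le b≤a = step-inverse (up-step excl b≤a le)

  dn-enabled : ∀ {a b x y} → x ≡ 0 ⊎ y ≡ 0 → b + y ≤ a + x → x ≤ a + x ∸ (b + y) → b ≤ a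
  dn-enabled {a} {b} {x} {y} (inj₁ refl) le _  = ≤-trans (m≤m+n b y) (subst (b + y ≤_) (+-identityʳ a) le)
  dn-enabled {a} {b} {x} {y} (inj₂ refl) le x≤ = +-cancelˡ-≤ x b a
    (subst₂ _≤_ (cong (x +_) (+-identityʳ b)) (+-comm a x) (m≤o∸n⇒m+n≤o x le x≤))

  -- With mult indexed from 0, u_{i+1} moves a unit from slot i − 1 to slot i (from nowhere if i = 0);
  -- d_{i+1} moves it back.
  genShift : Γ → ℕ → ℕ × ℕ
  genShift (up i) j = (δ i (suc j) , δ i j)
  genShift (dn i) j = (δ i j , δ i (suc j))

  Moves : (ℕ → ℕ × ℕ) → List ℕ → List ℕ → Set
  Moves d ρ ν = ∀ j → step (d j) (mult ρ j) ≡ just (mult ν j)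

  Enabled : (ℕ → ℕ × ℕ) → List ℕ → Set
  Enabled d ρ = ∀ j → ∃ λ m → step (d j) (mult ρ j) ≡ just m

  entry-incrAt-conj : ∀ i ρ k → entry (incrAt i (conj ρ)) k ≡ col ρ k + δ i k
  entry-incrAt-conj i ρ k = trans (entry-incrAt i (conj ρ) k) (cong (_+ δ i k) (entry-conj ρ k))

  col-decrAt-conj : ∀ i ρ {M′} → decrAt i (conj ρ) ≡ just M′ → ∀ k → col ρ k ≡ entry M′ k + δ i k
  col-decrAt-conj i ρ dec k = trans (sym (entry-conj ρ k)) (entry-decrAt i (conj ρ) dec k)

  actGen-moves : ∀ a {ρ ν} → actGen a ρ ≡ just ν → IsPartition ν × Moves (genShift a) ρ ν
  actGen-moves (up i) {ρ} eq with toPartition-just (incrAt i (conj ρ)) eq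
  ... | linked , refl = conj-isPartition L , λ j →
    trans (up-step (δ-adjacent i j) (col-antitone ρ j) (subst₂ _≤_ (cols (suc j)) (cols j) (linked⇒entry-antitone linked j)))
          (cong just (sym (trans (mult-conj linked j) (cong₂ _∸_ (cols j) (cols (suc j))))))
    where
    L = incrAt i (conj ρ)
    cols = entry-incrAt-conj i ρ
  actGen-moves (dn i) {ρ} eq with decrAt i (conj ρ) in dec
  ... | just M′ with toPartition-just M′ eq
  ...   | linked , refl = conj-isPartition M′ , λ j →
    trans (cong (step (δ i j , δ i (suc j))) (cong₂ _∸_ (cols j) (cols (suc j))))
          (trans (dn-step (δ-adjacent i j) (subst₂ _≤_ (cols (suc j)) (cols j) (col-antitone ρ j)) (linked⇒entry-antitone linked j))
                 (cong just (sym (mult-conj linked j))))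
    where cols = col-decrAt-conj i ρ dec

  actGen-enabled : ∀ a {ρ} → Enabled (genShift a) ρ → ∃ λ ν → actGen a ρ ≡ just ν
  actGen-enabled (up i) {ρ} enabled = conj L , toPartition-linked linked
    where
    L = incrAt i (conj ρ)
    cols = entry-incrAt-conj i ρ
    linked : Linked _≥_ L
    linked = entry-antitone⇒linked L λ j → subst₂ _≤_ (sym (cols (suc j))) (sym (cols j))
      (up-enabled (δ-adjacent i j) (col-antitone ρ j) (proj₁ (step-just (proj₂ (enabled j)))))
  actGen-enabled (dn i) {ρ} enabled with decrAt i (conj ρ) in dec
  ... | nothing = contradiction (subst (1 ≤_) col≡0 (≤-trans 1≤mult (m∸n≤m (col ρ i) (col ρ (suc i))))) λ ()
    where
    col≡0 : col ρ i ≡ 0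
    col≡0 = trans (sym (entry-conj ρ i)) (decrAt-nothing i (conj ρ) dec)
    1≤mult : 1 ≤ mult ρ i
    1≤mult = subst (_≤ mult ρ i) (δ-diagonal i) (proj₁ (step-just (proj₂ (enabled i))))
  ... | just M′ = conj M′ , toPartition-linked linked
    where
    cols = col-decrAt-conj i ρ dec
    linked : Linked _≥_ M′
    linked = entry-antitone⇒linked M′ λ j →
      dn-enabled (δ-adjacent i j) (subst₂ _≤_ (cols (suc j)) (cols j) (col-antitone ρ j))
        (subst (δ i j ≤_) (cong₂ _∸_ (cols j) (cols (suc j))) (proj₁ (step-just (proj₂ (enabled j)))))

  shifts : Word → ℕ → ℕ × ℕ
  shifts []      j = (0 , 0)
  shifts (a ∷ x) j = shifts x j ∙ genShift a j

  >>=-just : ∀ {A B : Set} {m : Maybe A} {f : A → Maybe B} {b} → (m >>= f) ≡ just b → ∃ λ a → m ≡ just a × f a ≡ just b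
  >>=-just {m = just a} eq = a , refl , eq

  actWord-isPartition : ∀ w {ρ ν} → IsPartition ρ → actWord w ρ ≡ just ν → IsPartition ν
  actWord-isPartition []      part refl = part
  actWord-isPartition (a ∷ x) {ρ} part eq with actWord x ρ
  ... | just ρ′ = proj₁ (actGen-moves a eq)

  actWord-moves : ∀ w {ρ ν} → actWord w ρ ≡ just ν → Moves (shifts w) ρ ν
  actWord-moves []      {ρ} refl j = step-identity (mult ρ j)
  actWord-moves (a ∷ x) {ρ} {ν} eq with actWord x ρ in eq-x
  ... | just ρ′ = λ j → begin
    step (shifts x j ∙ genShift a j) (mult ρ j)            ≡⟨ step-∙ (shifts x j) (genShift a j) (mult ρ j) ⟩
    (step (shifts x j) (mult ρ j) >>= step (genShift a j)) ≡⟨ cong (_>>= step (genShift a j)) (actWord-moves x eq-x j) ⟩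
    step (genShift a j) (mult ρ′ j)                        ≡⟨ proj₂ (actGen-moves a eq) j ⟩
    just (mult ν j)                                        ∎
    where open ≡-Reasoning

  enabled-suffix : ∀ a x {ρ} → Enabled (shifts (a ∷ x)) ρ → Enabled (shifts x) ρ
  enabled-suffix a x {ρ} enabled j with >>=-just (trans (sym (step-∙ (shifts x j) (genShift a j) (mult ρ j))) (proj₂ (enabled j)))
  ... | m , eq , _ = m , eq

  actWord-enabled : ∀ w {ρ} → Enabled (shifts w) ρ → ∃ λ ν → actWord w ρ ≡ just ν
  actWord-enabled []      {ρ} _       = ρ , refl
  actWord-enabled (a ∷ x) {ρ} enabled with actWord-enabled x (enabled-suffix a x {ρ} enabled)
  ... | ρ′ , eq-x = subst (λ m → ∃ λ ν → (m >>= actGen a) ≡ just ν) (sym eq-x) (actGen-enabled a λ j →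
    proj₁ (enabled j) , trans (cong (_>>= step (genShift a j)) (sym (actWord-moves x eq-x j)))
                              (trans (sym (step-∙ (shifts x j) (genShift a j) (mult ρ j))) (proj₂ (enabled j))))

  SameAction : Word → Word → Set
  SameAction x y = ∀ ρ → IsPartition ρ → actWord x ρ ≡ actWord y ρ

  shifts-≗⇒SameAction : ∀ v w → (∀ j → shifts v j ≡ shifts w j) → SameAction v w
  shifts-≗⇒SameAction v w same ρ part with actWord v ρ in eq-v | actWord w ρ in eq-w
  ... | nothing | nothing = refl
  ... | just ν  | just ν′ = cong just (mult-injective (actWord-isPartition v part eq-v) (actWord-isPartition w part eq-w)
    λ j → just-injective (trans (sym (actWord-moves v eq-v j))
                                (trans (cong (λ p → step p (mult ρ j)) (same j)) (actWord-moves w eq-w j))))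
  ... | just ν  | nothing with () ← trans (sym eq-w) (proj₂ (actWord-enabled w λ j →
          mult ν j , trans (cong (λ p → step p (mult ρ j)) (sym (same j))) (actWord-moves v eq-v j)))
  ... | nothing | just ν′ with () ← trans (sym eq-v) (proj₂ (actWord-enabled v λ j →
          mult ν′ j , trans (cong (λ p → step p (mult ρ j)) (same j)) (actWord-moves w eq-w j)))

  actWord-++ : ∀ u v ρ → actWord (u ++ v) ρ ≡ (actWord v ρ >>= actWord u)
  actWord-++ []      v ρ with actWord v ρ
  ... | nothing = refl
  ... | just _  = refl
  actWord-++ (a ∷ u) v ρ rewrite actWord-++ u v ρ with actWord v ρ
  ... | nothing = refl
  ... | just _  = refl

  SameAction-context : ∀ {x y} → SameAction x y → ∀ p w → SameAction ((p ++ x) ++ w) ((p ++ y) ++ w)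
  SameAction-context {x} {y} same p w ρ part
    rewrite actWord-++ (p ++ x) w ρ | actWord-++ (p ++ y) w ρ with actWord w ρ in eq
  ... | nothing = refl
  ... | just ν rewrite actWord-++ p x ν | actWord-++ p y ν | same ν (actWord-isPartition w part eq) = refl

  index : Γ → ℕ
  index (up i) = i
  index (dn i) = i

  wordBound : Word → ℕ
  wordBound w = max 0 (map (suc ∘ index) w)

  genShift-beyond : ∀ a {j} → index a < j → genShift a j ≡ (0 , 0)
  genShift-beyond (up i) i<j = cong₂ _,_ (δ-< (m<n⇒m<1+n i<j)) (δ-< i<j)
  genShift-beyond (dn i) i<j = cong₂ _,_ (δ-< i<j) (δ-< (m<n⇒m<1+n i<j))

  shifts-beyond : ∀ w {j} → wordBound w ≤ j → shifts w j ≡ (0 , 0)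
  shifts-beyond w {j} bound≤j = go w (All.map (λ lt → <-≤-trans lt bound≤j) (Allₚ.map⁻ (xs≤max 0 (map (suc ∘ index) w))))
    where
    go : ∀ w → All (λ a → index a < j) w → shifts w j ≡ (0 , 0)
    go []      []            = refl
    go (a ∷ x) (a<j ∷ x<j) rewrite go x x<j | genShift-beyond a a<j = refl

  need : Word → ℕ → ℕ
  need w j = proj₁ (shifts w j)

  weight : ℕ → Word → ℕ
  weight n w = sum (applyUpTo (need w) n)

  sum-applyUpTo-mono : ∀ n {f g} → (∀ j → j < n → f j ≤ g j) → sum (applyUpTo f n) ≤ sum (applyUpTo g n)
  sum-applyUpTo-mono zero    f≤g = z≤n
  sum-applyUpTo-mono (suc n) f≤g = +-mono-≤ (f≤g 0 (s≤s z≤n)) (sum-applyUpTo-mono n (λ j j<n → f≤g (suc j) (s≤s j<n)))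

  sum-applyUpTo-squeeze : ∀ n {f g} → (∀ j → j < n → f j ≤ g j) → sum (applyUpTo g n) ≤ sum (applyUpTo f n) →
                          ∀ j → j < n → f j ≡ g j
  sum-applyUpTo-squeeze (suc n) {f} {g} f≤g sum≤ j j<n = at j j<n
    where
    f≤g′ : ∀ j → j < n → f (suc j) ≤ g (suc j)
    f≤g′ j j<n = f≤g (suc j) (s≤s j<n)
    F = sum (applyUpTo (f ∘ suc) n)
    G = sum (applyUpTo (g ∘ suc) n)
    head : f 0 ≡ g 0
    head = ≤-antisym (f≤g 0 (s≤s z≤n))
      (+-cancelʳ-≤ G (g 0) (f 0) (≤-trans sum≤ (+-monoʳ-≤ (f 0) (sum-applyUpTo-mono n f≤g′))))
    rest : G ≤ F
    rest = +-cancelˡ-≤ (g 0) G F (≤-trans sum≤ (+-monoˡ-≤ F (f≤g 0 (s≤s z≤n))))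
    at : ∀ j → j < suc n → f j ≡ g j
    at zero    _           = head
    at (suc j) (s≤s j<n) = sum-applyUpTo-squeeze n f≤g′ rest j j<n

  acts-on-withMult-need : ∀ n w → (∀ j → n ≤ j → need w j ≡ 0) → ∃ λ μ → actWord w (withMult n (need w)) ≡ just μ
  acts-on-withMult-need n w w-beyond = actWord-enabled w λ j → need w j ∸ need w j + proj₂ (shifts w j)
    , trans (cong (step (shifts w j)) (mult-withMult n (need w) w-beyond j)) (step-enabled ≤-refl)

  -- ρ is the smallest partition on which w acts, so v needs at most as much as w in every slot; no
  -- smaller weight forces equality, and then equal images force equal second components.
  same-image⇒same-shifts : ∀ n v w {ρ μ} → (∀ j → mult ρ j ≡ need w j) → (∀ j → n ≤ j → need w j ≡ 0) →
    weight n w ≤ weight n v → actWord w ρ ≡ just μ → actWord v ρ ≡ just μ → ∀ j → shifts v j ≡ shifts w j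
  same-image⇒same-shifts n v w {ρ} {μ} ρ-mult w-beyond w≤v eq-w eq-v j =
    cong₂ _,_ need≡ (+-cancelˡ-≡ (need w j ∸ need w j) _ _ image≡)
    where
    moves-v : ∀ j → step (shifts v j) (need w j) ≡ just (mult μ j)
    moves-v j = trans (cong (step (shifts v j)) (sym (ρ-mult j))) (actWord-moves v eq-v j)
    moves-w : ∀ j → step (shifts w j) (need w j) ≡ just (mult μ j)
    moves-w j = trans (cong (step (shifts w j)) (sym (ρ-mult j))) (actWord-moves w eq-w j)
    v≤w : ∀ j → need v j ≤ need w j
    v≤w j = proj₁ (step-just (moves-v j))
    need≡ : need v j ≡ need w j
    need≡ with j <? n
    ... | yes j<n = sum-applyUpTo-squeeze n (λ j _ → v≤w j) w≤v j j<n
    ... | no  j≮n = ≤-antisym (v≤w j) (subst (_≤ need v j) (sym (w-beyond j (≮⇒≥ j≮n))) z≤n)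
    image≡ : need w j ∸ need w j + proj₂ (shifts v j) ≡ need w j ∸ need w j + proj₂ (shifts w j)
    image≡ = trans (cong (λ k → need w j ∸ k + proj₂ (shifts v j)) (sym need≡))
                   (trans (proj₂ (step-just (moves-v j))) (sym (proj₂ (step-just (moves-w j)))))

module Ideal {c ℓ : Level} (K : Field c ℓ) where

  open import Level using (_⊔_)
  open import Function.Base using (_∘_; const)
  open import Data.Nat as ℕ using (ℕ)
  import Data.Nat.Properties as ℕₚ
  open import Data.Nat.Induction using (<-wellFounded)
  open import Induction.WellFounded using (Acc; acc)
  open import Data.Bool using (if_then_else_)
  open import Data.List using (List; []; _∷_; _++_; map; filter; length)
  open import Data.List.Properties using (≡-dec; filter-notAll; ++-identityʳ; ++-assoc)
  open import Data.List.Relation.Unary.All as All using (All; []; _∷_)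
  import Data.List.Relation.Unary.All.Properties as Allₚ
  open import Data.List.Relation.Unary.Any as Any using (Any; here; there)
  open import Data.List.Membership.Propositional using (_∈_)
  open import Data.List.Extrema.Nat using (max; xs≤max; argmin; argmin-sel; f[argmin]≤f[⊤]; f[argmin]≤f[xs])
  open import Data.Sum using ([_,_]′)
  import Data.Maybe.Properties as Maybeₚ
  open import Function.Bundles using (Equivalence)
  open import Data.Maybe using (Maybe; just; nothing)
  open import Data.Product using (_×_; _,_; proj₁; proj₂)
  open import Relation.Unary using (Decidable)
  open import Relation.Nullary using (¬_; ¬?; yes; no; does; contradiction)
  open import Relation.Binary.PropositionalEquality as ≡ using (_≡_; _≢_)

  open Field K
  open Equivalence using (to; from)
  open FreeAlgebra K
  open import Relation.Binary.Reasoning.Setoid setoid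
  open import Algebra.Properties.Ring ring using (-1*x≈-x; -‿distribˡ-*; -‿distribʳ-*)
  open import Algebra.Properties.AbelianGroup +-abelianGroup using (x∙y⁻¹≈ε⇒x≈y; ε⁻¹≈ε; ⁻¹-∙-comm)
  open import Algebra.Properties.CommutativeSemigroup +-commutativeSemigroup using (x∙yz≈y∙xz; interchange)
  open Partitions

  eval : (Word → Carrier) → 𝒰 → Carrier
  eval φ []            = 0#
  eval φ ((a , w) ∷ f) = a * φ w + eval φ f

  coeffSum : 𝒰 → Carrier
  coeffSum = eval (const 1#)

  eval-++ : ∀ φ f g → eval φ (f ++ g) ≈ eval φ f + eval φ g
  eval-++ φ []            g = sym (+-identityˡ (eval φ g))
  eval-++ φ ((a , w) ∷ f) g = trans (+-congˡ (eval-++ φ f g)) (sym (+-assoc (a * φ w) (eval φ f) (eval φ g)))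

  eval-cong : ∀ {φ ψ} f → All (λ q → φ (proj₂ q) ≈ ψ (proj₂ q)) f → eval φ f ≈ eval ψ f
  eval-cong []      []         = refl
  eval-cong (_ ∷ f) (eq ∷ eqs) = +-cong (*-congˡ eq) (eval-cong f eqs)

  eval-const : ∀ k f → eval (const k) f ≈ coeffSum f * k
  eval-const k []            = sym (zeroˡ k)
  eval-const k ((a , w) ∷ f) = begin
    a * k + eval (const k) f            ≈⟨ +-cong (*-congʳ (sym (*-identityʳ a))) (eval-const k f) ⟩
    a * 1# * k + coeffSum f * k         ≈⟨ distribʳ k (a * 1#) (coeffSum f) ⟨
    (a * 1# + coeffSum f) * k           ∎

  eval-zero : ∀ {φ} f → All (λ q → φ (proj₂ q) ≈ 0#) f → eval φ f ≈ 0#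
  eval-zero f zeros = trans (eval-cong f zeros) (trans (eval-const 0# f) (zeroʳ (coeffSum f)))

  negate : 𝒰 → 𝒰
  negate []            = []
  negate ((a , w) ∷ f) = (- a , w) ∷ negate f

  eval-negate : ∀ φ f → eval φ (negate f) ≈ - eval φ f
  eval-negate φ []            = sym ε⁻¹≈ε
  eval-negate φ ((a , w) ∷ f) =
    trans (+-cong (sym (-‿distribˡ-* a (φ w))) (eval-negate φ f)) (⁻¹-∙-comm (a * φ w) (eval φ f))

  indicator : Word → Word → Carrier
  indicator w v = if does (v ≟W w) then 1# else 0#

  coeffU≈eval : ∀ w f → coeffU w f ≈ eval (indicator w) f
  coeffU≈eval w []            = refl
  coeffU≈eval w ((a , v) ∷ f) with v ≟W w
  ... | yes _ = +-cong (sym (*-identityʳ a)) (coeffU≈eval w f)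
  ... | no  _ = trans (coeffU≈eval w f) (sym (trans (+-congʳ (zeroʳ a)) (+-identityˡ _)))

  dropWord : Word → 𝒰 → 𝒰
  dropWord w = filter (λ q → ¬? (proj₂ q ≟W w))

  eval-split : ∀ φ w f → eval φ f ≈ eval (indicator w) f * φ w + eval φ (dropWord w f)
  eval-split φ w []            = sym (trans (+-identityʳ _) (zeroˡ (φ w)))
  eval-split φ w ((a , v) ∷ f) with v ≟W w
  ... | yes ≡.refl = begin
    a * φ v + eval φ f                                        ≈⟨ +-congˡ (eval-split φ v f) ⟩
    a * φ v + (eval (indicator v) f * φ v + eval φ (dropWord v f)) ≈⟨ +-assoc _ _ _ ⟨
    a * φ v + eval (indicator v) f * φ v + eval φ (dropWord v f)   ≈⟨ +-congʳ (+-congʳ (*-congʳ (*-identityʳ a))) ⟨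
    a * 1# * φ v + eval (indicator v) f * φ v + eval φ (dropWord v f) ≈⟨ +-congʳ (distribʳ (φ v) _ _) ⟨
    (a * 1# + eval (indicator v) f) * φ v + eval φ (dropWord v f) ∎
  ... | no _ = begin
    a * φ v + eval φ f                                             ≈⟨ +-congˡ (eval-split φ w f) ⟩
    a * φ v + (eval (indicator w) f * φ w + eval φ (dropWord w f)) ≈⟨ x∙yz≈y∙xz (a * φ v) _ _ ⟩
    eval (indicator w) f * φ w + (a * φ v + eval φ (dropWord w f)) ≈⟨ +-congʳ (*-congʳ (trans (+-congʳ (zeroʳ a)) (+-identityˡ _))) ⟨
    (a * 0# + eval (indicator w) f) * φ w + (a * φ v + eval φ (dropWord w f)) ∎

  indicator-dropWord-self : ∀ w f → eval (indicator w) (dropWord w f) ≈ 0#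
  indicator-dropWord-self w f =
    eval-zero {indicator w} (dropWord w f) (All.map (λ {q} → off {q}) (Allₚ.all-filter (λ q → ¬? (proj₂ q ≟W w)) f))
    where
    off : ∀ {q : Carrier × Word} → ¬ proj₂ q ≡ w → indicator w (proj₂ q) ≈ 0#
    off {_ , v} v≢w with v ≟W w
    ... | yes v≡w = contradiction v≡w v≢w
    ... | no  _   = refl

  indicator-dropWord-other : ∀ {w w′} f → w′ ≢ w → eval (indicator w′) (dropWord w f) ≈ eval (indicator w′) f
  indicator-dropWord-other {w} {w′} f w′≢w = sym (begin
    eval (indicator w′) f                                                      ≈⟨ eval-split (indicator w′) w f ⟩
    eval (indicator w) f * indicator w′ w + eval (indicator w′) (dropWord w f) ≈⟨ +-congʳ (trans (*-congˡ w′-off) (zeroʳ _)) ⟩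
    0# + eval (indicator w′) (dropWord w f)                                    ≈⟨ +-identityˡ _ ⟩
    eval (indicator w′) (dropWord w f)                                         ∎)
    where
    w′-off : indicator w′ w ≈ 0#
    w′-off with w ≟W w′
    ... | yes w≡w′ = contradiction (≡.sym w≡w′) w′≢w
    ... | no  _    = refl

  coefficients-zero⇒eval-zero : ∀ φ h → Acc ℕ._<_ (length h) → (∀ w → eval (indicator w) h ≈ 0#) → eval φ h ≈ 0#
  coefficients-zero⇒eval-zero φ []              _        _     = refl
  coefficients-zero⇒eval-zero φ h@((a , w) ∷ _) (acc rs) zeros = begin
    eval φ h                                                ≈⟨ eval-split φ w h ⟩
    eval (indicator w) h * φ w + eval φ (dropWord w h)      ≈⟨ +-cong (trans (*-congʳ (zeros w)) (zeroˡ (φ w))) rest ⟩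
    0# + 0#                                                 ≈⟨ +-identityʳ 0# ⟩
    0#                                                      ∎
    where
    shorter : length (dropWord w h) ℕ.< length h
    shorter = filter-notAll (λ q → ¬? (proj₂ q ≟W w)) h (here (λ w≢w → w≢w ≡.refl))
    rest-zeros : ∀ w′ → eval (indicator w′) (dropWord w h) ≈ 0#
    rest-zeros w′ with w′ ≟W w
    ... | yes ≡.refl = indicator-dropWord-self w h
    ... | no  w′≢w   = trans (indicator-dropWord-other h w′≢w) (zeros w′)
    rest = coefficients-zero⇒eval-zero φ (dropWord w h) (rs shorter) rest-zeros

  eval-≃ : ∀ φ f g → f ≃ g → eval φ f ≈ eval φ g
  eval-≃ φ f g f≃g = x∙y⁻¹≈ε⇒x≈y (eval φ f) (eval φ g) (begin
    eval φ f + - eval φ g             ≈⟨ +-congˡ (eval-negate φ g) ⟨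
    eval φ f + eval φ (negate g)      ≈⟨ eval-++ φ f (negate g) ⟨
    eval φ (f ++ negate g)            ≈⟨ coefficients-zero⇒eval-zero φ (f ++ negate g) (<-wellFounded _) zeros ⟩
    0#                                ∎)
    where
    zeros : ∀ w → eval (indicator w) (f ++ negate g) ≈ 0#
    zeros w = begin
      eval (indicator w) (f ++ negate g)                    ≈⟨ eval-++ (indicator w) f (negate g) ⟩
      eval (indicator w) f + eval (indicator w) (negate g)  ≈⟨ +-congˡ (eval-negate (indicator w) g) ⟩
      eval (indicator w) f + - eval (indicator w) g         ≈⟨ +-cong (coeffU≈eval w f) (-‿cong (coeffU≈eval w g)) ⟨
      coeffU w f + - coeffU w g                             ≈⟨ +-congʳ (f≃g w) ⟩
      coeffU w g + - coeffU w g                             ≈⟨ -‿inverseʳ (coeffU w g) ⟩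
      0#                                                    ∎

  -- F stands for the pattern lambda inside _⊗_, which cannot be named.
  eval-map-scale : ∀ φ a v (F : Carrier × Word → Carrier × Word) → (∀ b w → F (b , w) ≡ (a * b , v ++ w)) →
                   ∀ g → eval φ (map F g) ≈ a * eval (φ ∘ (v ++_)) g
  eval-map-scale φ a v F F≡ []            = sym (zeroʳ a)
  eval-map-scale φ a v F F≡ ((b , w) ∷ g) rewrite F≡ b w = begin
    a * b * φ (v ++ w) + eval φ (map F g)                ≈⟨ +-cong (*-assoc a b _) (eval-map-scale φ a v F F≡ g) ⟩
    a * (b * φ (v ++ w)) + a * eval (φ ∘ (v ++_)) g      ≈⟨ distribˡ a _ _ ⟨
    a * (b * φ (v ++ w) + eval (φ ∘ (v ++_)) g)          ∎

  eval-⊗ : ∀ φ f g → eval φ (f ⊗ g) ≈ eval (λ v → eval (φ ∘ (v ++_)) g) f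
  eval-⊗ φ []            g = refl
  eval-⊗ φ ((a , v) ∷ f) g =
    trans (eval-++ φ (map _ g) (f ⊗ g)) (+-cong (eval-map-scale φ a v _ (λ _ _ → ≡.refl) g) (eval-⊗ φ f g))

  eval-binom : ∀ φ x y → eval φ (binom x y) ≈ φ x - φ y
  eval-binom φ x y = +-cong (*-identityˡ (φ x)) (trans (+-identityʳ _) (-1*x≈-x (φ y)))

  hits : Maybe (List ℕ) → List ℕ → Carrier
  hits nothing  μ = 0#
  hits (just ν) μ = if does (≡-dec ℕ._≟_ ν μ) then 1# else 0#

  hits-self : ∀ ν → hits (just ν) ν ≡ 1#
  hits-self ν with ≡-dec ℕ._≟_ ν ν
  ... | yes _   = ≡.refl
  ... | no  ν≢ν = contradiction ≡.refl ν≢ν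

  hits-miss : ∀ m μ → m ≢ just μ → hits m μ ≡ 0#
  hits-miss nothing  μ _    = ≡.refl
  hits-miss (just ν) μ miss with ≡-dec ℕ._≟_ ν μ
  ... | yes ν≡μ = contradiction (≡.cong just ν≡μ) miss
  ... | no  _   = ≡.refl

  matrixEntry : List ℕ → List ℕ → Word → Carrier
  matrixEntry ρ μ w = hits (actWord w ρ) μ

  coeffY-act : ∀ μ ρ f → coeffY μ (act f ρ) ≈ eval (matrixEntry ρ μ) f
  coeffY-act μ ρ []            = refl
  coeffY-act μ ρ ((a , w) ∷ f) with actWord w ρ
  ... | nothing = trans (coeffY-act μ ρ f) (sym (trans (+-congʳ (zeroʳ a)) (+-identityˡ _)))
  ... | just ν with ≡-dec ℕ._≟_ ν μ
  ...   | yes _ = +-cong (sym (*-identityʳ a)) (coeffY-act μ ρ f)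
  ...   | no  _ = trans (coeffY-act μ ρ f) (sym (trans (+-congʳ (zeroʳ a)) (+-identityˡ _)))

  Annihilates : 𝒰 → Set ℓ
  Annihilates f = ∀ ρ μ → IsPartition ρ → IsPartition μ → eval (matrixEntry ρ μ) f ≈ 0#

  InI⇔Annihilates : ∀ f → InI f ⇔ Annihilates f
  InI⇔Annihilates f = mk⇔
    (λ inI ρ μ part-ρ part-μ → trans (sym (coeffY-act μ ρ f)) (inI (mkPartition ρ part-ρ) (mkPartition μ part-μ)))
    (λ ann ρ μ → trans (coeffY-act (parts μ) (parts ρ) f) (ann (parts ρ) (parts μ) (isPartition ρ) (isPartition μ)))

  hits-injective : ∀ m m′ → (∀ {ν} → m ≡ just ν → IsPartition ν) → (∀ {ν} → m′ ≡ just ν → IsPartition ν) →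
                   (∀ μ → IsPartition μ → hits m μ ≈ hits m′ μ) → m ≡ m′
  hits-injective nothing  nothing   _      _       _     = ≡.refl
  hits-injective nothing  (just ν′) _      part-m′ agree =
    contradiction (sym (trans (agree ν′ (part-m′ ≡.refl)) (reflexive (hits-self ν′)))) 1≉0
  hits-injective (just ν) m′        part-m _       agree with Maybeₚ.≡-dec (≡-dec ℕ._≟_) m′ (just ν)
  ... | yes m′≡ν = ≡.sym m′≡ν
  ... | no  m′≢ν = contradiction (trans (reflexive (≡.sym (hits-self ν)))
                                        (trans (agree ν (part-m ≡.refl)) (reflexive (hits-miss m′ ν m′≢ν)))) 1≉0

  InI-binom⇔SameAction : ∀ x y → InI (binom x y) ⇔ SameAction x y
  InI-binom⇔SameAction x y = mk⇔
    (λ inI ρ part → hits-injective (actWord x ρ) (actWord y ρ) (actWord-isPartition x part) (actWord-isPartition y part)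
       λ μ part-μ → x∙y⁻¹≈ε⇒x≈y _ _ (trans (sym (eval-binom (matrixEntry ρ μ) x y))
                                          (to (InI⇔Annihilates (binom x y)) inI ρ μ part part-μ)))
    (λ same → from (InI⇔Annihilates (binom x y)) λ ρ μ part _ →
       trans (eval-binom (matrixEntry ρ μ) x y)
             (trans (+-congʳ (reflexive (≡.cong (λ m → hits m μ) (same ρ part)))) (-‿inverseʳ _)))

  annihilates-term : ∀ {x y} → SameAction x y → ∀ a b → Annihilates ((a ⊗ binom x y) ⊗ b)
  annihilates-term {x} {y} same a b ρ μ part _ = begin
    eval φ ((a ⊗ binom x y) ⊗ b)                                ≈⟨ eval-⊗ φ (a ⊗ binom x y) b ⟩
    eval ψ (a ⊗ binom x y)                                      ≈⟨ eval-⊗ ψ a (binom x y) ⟩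
    eval (λ p → eval (ψ ∘ (p ++_)) (binom x y)) a               ≈⟨ eval-zero a (All.universal cancels a) ⟩
    0#                                                          ∎
    where
    φ = matrixEntry ρ μ
    ψ : Word → Carrier
    ψ u = eval (φ ∘ (u ++_)) b
    cancels : ∀ (q : Carrier × Word) → eval (ψ ∘ (proj₂ q ++_)) (binom x y) ≈ 0#
    cancels (_ , p) = trans (eval-binom (ψ ∘ (p ++_)) x y) (trans (+-congʳ same-ψ) (-‿inverseʳ _))
      where
      same-ψ : ψ (p ++ x) ≈ ψ (p ++ y)
      same-ψ = eval-cong b (All.universal
        (λ q → reflexive (≡.cong (λ m → hits m μ) (SameAction-context same p (proj₂ q) ρ part))) b)

  annihilates-sumTerms : ∀ ts → All (λ { (a , s , b) → BinomialInI s }) ts → Annihilates (sumTerms ts)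
  annihilates-sumTerms []                  []                               ρ μ _    _      = refl
  annihilates-sumTerms ((a , s , b) ∷ ts) ((x , y , ≡.refl , inI) ∷ gens) ρ μ part part-μ = begin
    eval φ (((a ⊗ s) ⊗ b) ++ sumTerms ts)          ≈⟨ eval-++ φ ((a ⊗ s) ⊗ b) (sumTerms ts) ⟩
    eval φ ((a ⊗ s) ⊗ b) + eval φ (sumTerms ts)   ≈⟨ +-cong term (annihilates-sumTerms ts gens ρ μ part part-μ) ⟩
    0# + 0#                                        ≈⟨ +-identityʳ 0# ⟩
    0#                                             ∎
    where
    φ = matrixEntry ρ μ
    term = annihilates-term (to (InI-binom⇔SameAction x y) inI) a b ρ μ part part-μ

  InIdeal⇒InI : ∀ f → InIdeal BinomialInI f → InI f
  InIdeal⇒InI f (ts , gens , f≃) = from (InI⇔Annihilates f) λ ρ μ part part-μ →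
    trans (eval-≃ (matrixEntry ρ μ) f (sumTerms ts) f≃) (annihilates-sumTerms ts gens ρ μ part part-μ)

  coeffU-++ : ∀ w f g → coeffU w (f ++ g) ≈ coeffU w f + coeffU w g
  coeffU-++ w f g = trans (coeffU≈eval w (f ++ g))
    (trans (eval-++ (indicator w) f g) (sym (+-cong (coeffU≈eval w f) (coeffU≈eval w g))))

  sumTerms-++ : ∀ ts ts′ → sumTerms (ts ++ ts′) ≡ sumTerms ts ++ sumTerms ts′
  sumTerms-++ []                  ts′ = ≡.refl
  sumTerms-++ ((a , s , b) ∷ ts) ts′ =
    ≡.trans (≡.cong (((a ⊗ s) ⊗ b) ++_) (sumTerms-++ ts ts′)) (≡.sym (++-assoc ((a ⊗ s) ⊗ b) (sumTerms ts) (sumTerms ts′)))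

  InIdeal-⊕ : ∀ {p} {S : 𝒰 → Set p} f g → InIdeal S f → InIdeal S g → InIdeal S (f ⊕ g)
  InIdeal-⊕ f g (ts , gens , f≃) (ts′ , gens′ , g≃) = ts ++ ts′ , Allₚ.++⁺ gens gens′ , λ w → begin
    coeffU w (f ++ g)                                  ≈⟨ coeffU-++ w f g ⟩
    coeffU w f + coeffU w g                            ≈⟨ +-cong (f≃ w) (g≃ w) ⟩
    coeffU w (sumTerms ts) + coeffU w (sumTerms ts′)   ≈⟨ coeffU-++ w (sumTerms ts) (sumTerms ts′) ⟨
    coeffU w (sumTerms ts ++ sumTerms ts′)             ≡⟨ ≡.cong (coeffU w) (sumTerms-++ ts ts′) ⟨
    coeffU w (sumTerms (ts ++ ts′))                    ∎

  InIdeal-≃ : ∀ {p} {S : 𝒰 → Set p} f g → f ≃ g → InIdeal S g → InIdeal S f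
  InIdeal-≃ f g f≃g (ts , gens , g≃) = ts , gens , λ w → trans (f≃g w) (g≃ w)

  InI-cancel : ∀ f g h → f ≃ (g ⊕ h) → InI f → InI g → InI h
  InI-cancel f g h f≃ inI-f inI-g = from (InI⇔Annihilates h) λ ρ μ part part-μ → begin
    eval (matrixEntry ρ μ) h                                    ≈⟨ +-identityˡ _ ⟨
    0# + eval (matrixEntry ρ μ) h                               ≈⟨ +-congʳ (to (InI⇔Annihilates g) inI-g ρ μ part part-μ) ⟨
    eval (matrixEntry ρ μ) g + eval (matrixEntry ρ μ) h         ≈⟨ eval-++ (matrixEntry ρ μ) g h ⟨
    eval (matrixEntry ρ μ) (g ⊕ h)                              ≈⟨ eval-≃ (matrixEntry ρ μ) f (g ⊕ h) f≃ ⟨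
    eval (matrixEntry ρ μ) f                                    ≈⟨ to (InI⇔Annihilates f) inI-f ρ μ part part-μ ⟩
    0#                                                          ∎

  eval-filter : ∀ {p} {P : Carrier × Word → Set p} (P? : Decidable P) φ f →
                eval φ f ≈ eval φ (filter P? f) + eval φ (filter (¬? ∘ P?) f)
  eval-filter P? φ []            = sym (+-identityˡ 0#)
  eval-filter P? φ ((a , w) ∷ f) with P? (a , w)
  ... | yes _ = trans (+-congˡ (eval-filter P? φ f)) (sym (+-assoc _ _ _))
  ... | no  _ = trans (+-congˡ (eval-filter P? φ f)) (x∙yz≈y∙xz _ _ _)

  binomTerm : Word → Carrier × Word → 𝒰 × 𝒰 × 𝒰
  binomTerm A (c , v) = ((c , []) ∷ [] , binom v A , mon [])

  eval-binomTerm : ∀ φ A c v → eval φ ((((c , []) ∷ []) ⊗ binom v A) ⊗ mon []) ≈ c * (φ v - φ A)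
  eval-binomTerm φ A c v = begin
    eval φ ((((c , []) ∷ []) ⊗ binom v A) ⊗ mon [])   ≈⟨ eval-⊗ φ (((c , []) ∷ []) ⊗ binom v A) (mon []) ⟩
    eval ψ (((c , []) ∷ []) ⊗ binom v A)               ≈⟨ eval-⊗ ψ ((c , []) ∷ []) (binom v A) ⟩
    c * eval ψ (binom v A) + 0#                        ≈⟨ +-identityʳ _ ⟩
    c * eval ψ (binom v A)                             ≈⟨ *-congˡ (eval-cong (binom v A) (All.universal (ψ≈φ ∘ proj₂) (binom v A))) ⟩
    c * eval φ (binom v A)                             ≈⟨ *-congˡ (eval-binom φ v A) ⟩
    c * (φ v - φ A)                                    ∎
    where
    ψ : Word → Carrier
    ψ u = eval (φ ∘ (u ++_)) (mon [])
    ψ≈φ : ∀ u → ψ u ≈ φ u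
    ψ≈φ u = trans (+-identityʳ _) (trans (*-identityˡ _) (reflexive (≡.cong φ (++-identityʳ u))))

  eval-binomTerms : ∀ φ A h → eval φ (sumTerms (map (binomTerm A) h)) ≈ eval φ h - coeffSum h * φ A
  eval-binomTerms φ A [] = sym (trans (+-congˡ (-‿cong (zeroˡ (φ A)))) (-‿inverseʳ 0#))
  eval-binomTerms φ A ((c , v) ∷ h) = begin
    eval φ (T₀ ++ T)                                              ≈⟨ eval-++ φ T₀ T ⟩
    eval φ T₀ + eval φ T                                          ≈⟨ +-cong (eval-binomTerm φ A c v) (eval-binomTerms φ A h) ⟩
    c * (φ v - φ A) + (eval φ h - coeffSum h * φ A)               ≈⟨ +-congʳ (trans (distribˡ c (φ v) (- φ A)) c*-y) ⟩
    (c * φ v - c * φ A) + (eval φ h - coeffSum h * φ A)           ≈⟨ interchange _ _ _ _ ⟩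
    (c * φ v + eval φ h) + (- (c * φ A) + - (coeffSum h * φ A))   ≈⟨ +-congˡ (⁻¹-∙-comm _ _) ⟩
    (c * φ v + eval φ h) - (c * φ A + coeffSum h * φ A)           ≈⟨ +-congˡ (-‿cong split-coeff) ⟨
    (c * φ v + eval φ h) - (c * 1# + coeffSum h) * φ A            ∎
    where
    T₀ = (((c , []) ∷ []) ⊗ binom v A) ⊗ mon []
    T  = sumTerms (map (binomTerm A) h)
    c*-y : c * φ v + c * - φ A ≈ c * φ v - c * φ A
    c*-y = +-congˡ (sym (-‿distribʳ-* c (φ A)))
    split-coeff : (c * 1# + coeffSum h) * φ A ≈ c * φ A + coeffSum h * φ A
    split-coeff = trans (distribʳ (φ A) (c * 1#) (coeffSum h)) (+-congʳ (*-congʳ (*-identityʳ c)))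

  binomTerms-InIdeal : ∀ A h → All (λ q → SameAction (proj₂ q) A) h → InIdeal BinomialInI (sumTerms (map (binomTerm A) h))
  binomTerms-InIdeal A h same = map (binomTerm A) h
    , Allₚ.map⁺ (All.map (λ {q} same-q → proj₂ q , A , ≡.refl , from (InI-binom⇔SameAction (proj₂ q) A) same-q) same)
    , λ _ → refl

  record Peeling (f : 𝒰) : Set (c ⊔ ℓ) where
    field
      pivot            : Word
      class rest       : 𝒰
      class-sameAction : All (λ q → SameAction (proj₂ q) pivot) class
      class-coeffSum   : coeffSum class ≈ 0#
      split            : ∀ φ → eval φ f ≈ eval φ class + eval φ rest
      rest-shorter     : length rest ℕ.< length f

    classTerms : 𝒰
    classTerms = sumTerms (map (binomTerm pivot) class)

    ≃-classTerms⊕rest : f ≃ (classTerms ⊕ rest)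
    ≃-classTerms⊕rest w = begin
      coeffU w f                                                  ≈⟨ coeffU≈eval w f ⟩
      eval (indicator w) f                                        ≈⟨ split (indicator w) ⟩
      eval (indicator w) class + eval (indicator w) rest          ≈⟨ +-congʳ class≈terms ⟨
      eval (indicator w) classTerms + eval (indicator w) rest     ≈⟨ eval-++ (indicator w) classTerms rest ⟨
      eval (indicator w) (classTerms ⊕ rest)                      ≈⟨ coeffU≈eval w (classTerms ⊕ rest) ⟨
      coeffU w (classTerms ⊕ rest)                                ∎
      where
      class≈terms : eval (indicator w) classTerms ≈ eval (indicator w) class
      class≈terms = begin
        eval (indicator w) classTerms                                          ≈⟨ eval-binomTerms (indicator w) pivot class ⟩
        eval (indicator w) class - coeffSum class * indicator w pivot          ≈⟨ +-congˡ (-‿cong (trans (*-congʳ class-coeffSum) (zeroˡ _))) ⟩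
        eval (indicator w) class - 0#                                          ≈⟨ +-congˡ ε⁻¹≈ε ⟩
        eval (indicator w) class + 0#                                          ≈⟨ +-identityʳ _ ⟩
        eval (indicator w) class                                               ∎

  open Peeling

  peeling-from-test : ∀ {f} N A {ρ μ} →
    IsPartition ρ → (∀ j → mult ρ j ≡ need A j) → (∀ j → N ℕ.≤ j → need A j ≡ 0) → actWord A ρ ≡ just μ →
    Any (λ q → A ≡ proj₂ q) f → All (λ q → weight N A ℕ.≤ weight N (proj₂ q)) f → InI f → Peeling f
  peeling-from-test {f} N A {ρ} {μ} ρ-isPartition ρ-mult A-beyond image-A A∈f lightest inI = record
    { pivot            = A
    ; class            = filter hits? f
    ; rest             = filter (¬? ∘ hits?) f
    ; class-sameAction = All.map (λ {q} (hit , light) → shifts-≗⇒SameAction (proj₂ q) A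
                                   (same-image⇒same-shifts N (proj₂ q) A ρ-mult A-beyond light image-A hit))
                                 (All.zip (Allₚ.all-filter hits? f , Allₚ.filter⁺ hits? lightest))
    ; class-coeffSum   = coeffSum-class
    ; split            = λ φ → eval-filter hits? φ f
    ; rest-shorter     = filter-notAll (¬? ∘ hits?) f (Any.map (λ { ≡.refl miss → miss image-A }) A∈f)
    }
    where
    Hits : Carrier × Word → Set
    Hits q = actWord (proj₂ q) ρ ≡ just μ
    hits? : Decidable Hits
    hits? q = Maybeₚ.≡-dec (≡-dec ℕ._≟_) (actWord (proj₂ q) ρ) (just μ)
    φ : Word → Carrier
    φ = matrixEntry ρ μ
    class-ones : eval φ (filter hits? f) ≈ coeffSum (filter hits? f)
    class-ones = eval-cong (filter hits? f)
      (All.map (λ hit → reflexive (≡.trans (≡.cong (λ m → hits m μ) hit) (hits-self μ))) (Allₚ.all-filter hits? f))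
    rest-zeros : eval φ (filter (¬? ∘ hits?) f) ≈ 0#
    rest-zeros = eval-zero (filter (¬? ∘ hits?) f)
      (All.map (λ miss → reflexive (hits-miss _ μ miss)) (Allₚ.all-filter (¬? ∘ hits?) f))
    coeffSum-class : coeffSum (filter hits? f) ≈ 0#
    coeffSum-class = begin
      coeffSum (filter hits? f)                                 ≈⟨ class-ones ⟨
      eval φ (filter hits? f)                                   ≈⟨ +-identityʳ _ ⟨
      eval φ (filter hits? f) + 0#                              ≈⟨ +-congˡ rest-zeros ⟨
      eval φ (filter hits? f) + eval φ (filter (¬? ∘ hits?) f)  ≈⟨ eval-filter hits? φ f ⟨
      eval φ f                                                  ≈⟨ to (InI⇔Annihilates f) inI ρ μ ρ-isPartition μ-isPartition ⟩
      0#                                                        ∎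
      where μ-isPartition = actWord-isPartition A ρ-isPartition image-A

  peel : ∀ q f → InI (q ∷ f) → Peeling (q ∷ f)
  peel q f inI = peeling-from-test N A (conj-isPartition (colsOf N (need A))) (mult-withMult N (need A) A-beyond) A-beyond
                   (proj₂ (acts-on-withMult-need N A A-beyond)) (Any.map (≡.cong proj₂) A∈) lightest inI
    where
    N : ℕ
    N = max 0 (map (wordBound ∘ proj₂) (q ∷ f))
    qA : Carrier × Word
    qA = argmin (weight N ∘ proj₂) q f
    A : Word
    A = proj₂ qA
    A∈ : qA ∈ q ∷ f
    A∈ = [ here , there ]′ (argmin-sel (weight N ∘ proj₂) q f)
    lightest : All (λ q′ → weight N A ℕ.≤ weight N (proj₂ q′)) (q ∷ f)
    lightest = f[argmin]≤f[⊤] {f = weight N ∘ proj₂} q f ∷ f[argmin]≤f[xs] {f = weight N ∘ proj₂} q f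
    bounds : All (λ q′ → wordBound (proj₂ q′) ℕ.≤ N) (q ∷ f)
    bounds = Allₚ.map⁻ (xs≤max 0 (map (wordBound ∘ proj₂) (q ∷ f)))
    A-beyond : ∀ j → N ℕ.≤ j → need A j ≡ 0
    A-beyond j N≤j = ≡.cong proj₁ (shifts-beyond A (ℕₚ.≤-trans (All.lookup bounds A∈) N≤j))

  InI⇒InIdeal : ∀ f → InI f → InIdeal BinomialInI f
  InI⇒InIdeal f = go f (<-wellFounded (length f))
    where
    go : ∀ f → Acc ℕ._<_ (length f) → InI f → InIdeal BinomialInI f
    go []      _        _   = [] , [] , λ _ → refl
    go (q ∷ f) (acc rs) inI =
      InIdeal-≃ (q ∷ f) (classTerms P ⊕ rest P) f≃ (InIdeal-⊕ (classTerms P) (rest P) terms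
        (go (rest P) (rs (rest-shorter P)) (InI-cancel (q ∷ f) (classTerms P) (rest P) f≃ inI (InIdeal⇒InI (classTerms P) terms))))
      where
      P : Peeling (q ∷ f)
      P = peel q f inI
      f≃ : (q ∷ f) ≃ (classTerms P ⊕ rest P)
      f≃ = ≃-classTerms⊕rest P
      terms : InIdeal BinomialInI (classTerms P)
      terms = binomTerms-InIdeal (pivot P) (class P) (class-sameAction P)

proposition3p2 : ∀ {c ℓ : Level} (K : Field c ℓ) (f : FreeAlgebra.𝒰 K) →
    FreeAlgebra.InI K f ⇔ FreeAlgebra.InIdeal K (FreeAlgebra.BinomialInI K) f
proposition3p2 K f = mk⇔ (Ideal.InI⇒InIdeal K f) (Ideal.InIdeal⇒InI K f)
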